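{- Let $(X,\pi)$ be a weighted $n$-partite simplicial complex in which every link graph is connected. For $T\subseteq[n]$ define $\mathcal U_T=\mathrm{span}\{u_\alpha:\alpha\in X[[n]\setminus T]\}\subseteq\mathbb R^{X^{(n)}}$, where $u_\alpha(\omega)=\mathbf 1[\omega\supseteq\alpha]$, and write $\mathcal U_t=\mathcal U_{\{t\}}$. Then for every $T\subseteq[n]$ (with the convention that the empty intersection is $\mathbb R^{X^{(n)}}$), \[\mathcal U_T=\bigcap_{t\in T}\mathcal U_t.\]
   Context: An $n$-partite simplicial complex $X$ is a downward-closed family of subsets of a finite vertex set whose inclusion-maximal faces all have size $n$, with vertices partitioned into sides $X[1],\dots,X[n]$ such that each face $\omega\in X^{(n)}$ of size $n$ contains exactly one vertex in each side; $\mathrm{typ}(\alpha)=\{i:\alpha\cap X[i]\neq\emptyset\}$ and $X[S]$ is the set of faces of type $S$. $X$ is weighted by a full-support probability distribution $\pi$ on $X^{(n)}$. For a face $\alpha$ with $|\alpha|\le n-2$, the link graph $G_\alpha$ has vertex set $\{v\notin\alpha:\alpha\cup\{v\}\in X\}$ and edges $\{x,y\}$ with $\alpha\cup\{x,y\}\in X$ (weighted by the $\pi$-mass of facets containing $\alpha\cup\{x,y\}$); "every link graph is connected" means $G_\alpha$ is connected for all such $\alpha$. -}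

module Defs where

open import Level using (Level; _⊔_; suc)
open import Data.Nat using (ℕ; _≤_) renaming (_+_ to _+ℕ_)
open import Data.Fin using (Fin; _≟_)
open import Data.Fin.Properties using (any?)
open import Data.Fin.Subset using (Subset; _∈_; _∉_; _⊆_; _∪_; ⁅_⁆; ∣_∣; ∁)
open import Data.Fin.Subset.Properties using (_⊆?_)
open import Data.Vec using (tabulate)
open import Data.List using (List; foldr)
open import Data.List.Relation.Unary.All using (All)
open import Data.Product using (Σ; ∃; _×_; _,_; proj₁; proj₂)
open import Data.Bool using (if_then_else_)
open import Relation.Nullary using (¬_; does)
open import Relation.Binary.PropositionalEquality using (_≡_)
open import Relation.Binary.Construct.Closure.ReflexiveTransitive using (Star)
open import Function.Bundles using (_⇔_)
open import Algebra.Bundles using (CommutativeRing)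

-- Fields (the stdlib has no Field bundle; ℝ is an instance of this).

record Field (c ℓ : Level) : Set (Level.suc (c ⊔ ℓ)) where
  field
    commutativeRing : CommutativeRing c ℓ
  open CommutativeRing commutativeRing public
  field
    0≉1     : ¬ (0# ≈ 1#)
    inverse : ∀ x → ¬ (x ≈ 0#) → Σ Carrier λ y → x * y ≈ 1#

-- n-partite simplicial complexes, presented by their facets.
-- Faces of X: subsets of vertices contained in some facet (downward closure),
-- so X is pure with maximal faces exactly the facets, each of size n with one
-- vertex on each side.

record Partite (n : ℕ) : Set where
  field
    V       : ℕ
    side    : Fin V → Fin n
    F       : ℕ
    facet   : Fin F → Fin n → Fin V
    typed   : ∀ ω i → side (facet ω i) ≡ i
    distinct : ∀ ω ω′ → (∀ i → facet ω i ≡ facet ω′ i) → ω ≡ ω′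

module _ {n : ℕ} (X : Partite n) where
  open Partite X

  facetSet : Fin F → Subset V
  facetSet ω = tabulate λ v → does (any? λ i → facet ω i ≟ v)

  IsFace : Subset V → Set
  IsFace α = ∃ λ ω → α ⊆ facetSet ω

  HasType : Subset n → Subset V → Set
  HasType S α = ∀ i → (i ∈ S ⇔ ∃ λ v → v ∈ α × side v ≡ i)

  FaceOfType : Subset n → Subset V → Set
  FaceOfType S α = IsFace α × HasType S α

  LinkVertex : Subset V → Fin V → Set
  LinkVertex α x = x ∉ α × IsFace (α ∪ ⁅ x ⁆)

  LinkEdge : Subset V → Fin V → Fin V → Set
  LinkEdge α x y = LinkVertex α x × LinkVertex α y × ¬ (x ≡ y)
                   × IsFace (α ∪ (⁅ x ⁆ ∪ ⁅ y ⁆))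

  LinkConnected : Subset V → Set
  LinkConnected α = ∀ x y → LinkVertex α x → LinkVertex α y → Star (LinkEdge α) x y

  AllLinksConnected : Set
  AllLinksConnected = ∀ α → IsFace α → ∣ α ∣ +ℕ 2 ≤ n → LinkConnected α

  module _ {c ℓ} (K : Field c ℓ) where
    open Field K

    Vector : Set c
    Vector = Fin F → Carrier

    u : Subset V → Vector
    u α ω = if does (α ⊆? facetSet ω) then 1# else 0#

    lincomb : List (Carrier × Subset V) → Vector
    lincomb cs ω = foldr (λ p acc → proj₁ p * u (proj₂ p) ω + acc) 0# cs

    InU : Subset n → Vector → Set (c ⊔ ℓ)
    InU T v = Σ (List (Carrier × Subset V)) λ cs →
                All (λ p → FaceOfType (∁ T) (proj₂ p)) cs
                × (∀ ω → v ω ≈ lincomb cs ω)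

-- A vector lies in U_T iff it is invariant under changing a facet on the
-- sides in T, i.e. iff it is constant on the classes of facets agreeing off T.
-- So the theorem says that invariance under each single side t ∈ T implies
-- invariance under all of T. By induction on |B| for B ⊆ T, |B| ≥ 2: two facets
-- σ, ω agreeing off B both contain α = σ ∩ X[[n] ∖ B], a face with |α| ≤ n - 2. Facets through
-- α ∪ {x}, for x in the link of α, agree off B minus the side of x, so v is
-- constant on them by induction; an edge xy of the link gives a facet through
-- both, and connectivity of the link carries the value of v from σ to ω.
module Submission where

open import Defs
open import Level using (Level)
open import Data.Nat using (ℕ)
open import Data.Fin.Subset using (Subset; _∈_; ⁅_⁆)
open import Function.Bundles using (_⇔_)

open import Data.Nat using (suc; _∸_; _≤_; _<_; z≤n; s≤s) renaming (_+_ to _+ℕ_)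
open import Data.Nat.Properties using (≤-reflexive; ≤-trans; +-mono-≤; +-monoʳ-≤; +-suc; m∸n+n≡m; module ≤-Reasoning)
open import Data.Nat.Induction using (<-wellFounded)
open import Data.Fin using (Fin; _≟_) renaming (zero to fzero; suc to fsuc)
open import Data.Fin.Properties using (any?; all?)
open import Data.Fin.Subset using (_∉_; _⊆_; _∪_; ∣_∣; ∁; _-_; ⊥; inside; outside; Nonempty)
open import Data.Fin.Subset.Properties
  using (_⊆?_; _∈?_; nonempty?; ∉⊥; ∣⊥∣≡0; x∈⁅x⁆; x∈⁅y⁆⇒x≡y; ∣⁅x⁆∣≡1; x∈∁p⇒x∉p; x∉p⇒x∈∁p;
         x∉∁p⇒x∈p; p⊆q⇒∁p⊇∁q; ⊆-trans; x∈p∧x≢y⇒x∈p-y; x∈p⇒p-x⊂p; x∈p⇒∣p-x∣<∣p∣; ∣∁p∣≡n∸∣p∣;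
         ∣p∣≤n; p⊆q⇒∣p∣≤∣q∣; p⊆p∪q; q⊆p∪q; x∈p∪q⁻; x∈p∪q⁺; ∣p∣≤∣x∷p∣)
open import Data.Vec using ([]; _∷_; here; there)
open import Data.Vec.Properties using ([]=⇒lookup; lookup⇒[]=; lookup∘tabulate)
open import Data.List using (List; []; _∷_; foldr; allFin)
open import Data.List.Relation.Unary.Any as Any using (Any)
open import Data.List.Membership.Propositional.Properties using (∈-allFin)
open import Data.List.Relation.Unary.All using (All; []; _∷_)
open import Data.Product using (Σ; ∃; _×_; _,_; proj₁; proj₂)
open import Data.Sum using (inj₁; inj₂; [_,_]′)
open import Data.Bool using (Bool; true; if_then_else_)
open import Data.Empty using (⊥-elim)
open import Relation.Nullary using (¬_; yes; no; does; proof)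
open import Relation.Nullary.Reflects using (Reflects; invert)
open import Relation.Nullary.Decidable using (dec-true; dec-false; does-⇔; _→-dec_)
open import Relation.Unary using (Pred)
open import Relation.Binary using (Rel; IsDecEquivalence)
open import Relation.Binary.PropositionalEquality as ≡ using (_≡_; refl; cong; subst)
open import Relation.Binary.Construct.Closure.ReflexiveTransitive using (Star; ε; _◅_)
open import Relation.Binary.Construct.On as On using ()
open import Induction.WellFounded using (Acc; acc)
open import Function using (_∘_; _on_; id)
open import Function.Bundles using (mk⇔; Equivalence)
import Function.Properties.Equivalence as ⇔
open import Data.Product.Function.NonDependent.Propositional using (_×-⇔_)
open import Algebra.Bundles using (Semiring)

open Equivalence using (to; from)

∪⊆⇔ : ∀ {m} {p q r : Subset m} → p ∪ q ⊆ r ⇔ (p ⊆ r × q ⊆ r)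
∪⊆⇔ {p = p} {q} {r} = mk⇔ split join
  where
  split : p ∪ q ⊆ r → p ⊆ r × q ⊆ r
  split h = ⊆-trans (p⊆p∪q q) h , ⊆-trans (q⊆p∪q p q) h
  join : p ⊆ r × q ⊆ r → p ∪ q ⊆ r
  join (hp , hq) x∈ = [ hp , hq ]′ (x∈p∪q⁻ p q x∈)

⁅x⁆⊆⇔∈ : ∀ {m} {x : Fin m} {p : Subset m} → ⁅ x ⁆ ⊆ p ⇔ x ∈ p
⁅x⁆⊆⇔∈ {x = x} {p} = mk⇔ (λ h → h (x∈⁅x⁆ x)) (λ x∈ {y} y∈ → subst (_∈ p) (≡.sym (x∈⁅y⁆⇒x≡y x y∈)) x∈)

∪-∪-⊆⇒∪-⊆ˡ : ∀ {m} {p q s r : Subset m} → p ∪ (q ∪ s) ⊆ r → p ∪ q ⊆ r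
∪-∪-⊆⇒∪-⊆ˡ h = let hp , hqs = to ∪⊆⇔ h in from ∪⊆⇔ (hp , proj₁ (to ∪⊆⇔ hqs))

∪-∪-⊆⇒∪-⊆ʳ : ∀ {m} {p q s r : Subset m} → p ∪ (q ∪ s) ⊆ r → p ∪ s ⊆ r
∪-∪-⊆⇒∪-⊆ʳ h = let hp , hqs = to ∪⊆⇔ h in from ∪⊆⇔ (hp , proj₂ (to ∪⊆⇔ hqs))

p-x-empty⇒p⊆⁅x⁆ : ∀ {m} {p : Subset m} {x} → ¬ Nonempty (p - x) → p ⊆ ⁅ x ⁆
p-x-empty⇒p⊆⁅x⁆ {x = x} p-x-empty {y} y∈p with y ≟ x
... | yes refl = x∈⁅x⁆ x
... | no y≢x = ⊥-elim (p-x-empty (y , x∈p∧x≢y⇒x∈p-y y∈p y≢x))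

x∈p∧y∈p-x⇒2≤∣p∣ : ∀ {m} {p : Subset m} {x y} → x ∈ p → y ∈ p - x → 2 ≤ ∣ p ∣
x∈p∧y∈p-x⇒2≤∣p∣ {x = x} {y} x∈p y∈p-x = ≤-trans
  (s≤s (≤-trans (≤-reflexive (≡.sym (∣⁅x⁆∣≡1 y))) (p⊆q⇒∣p∣≤∣q∣ (from ⁅x⁆⊆⇔∈ y∈p-x))))
  (x∈p⇒∣p-x∣<∣p∣ x∈p)

∣p∪q∣≤∣p∣+∣q∣ : ∀ {m} (p q : Subset m) → ∣ p ∪ q ∣ ≤ ∣ p ∣ +ℕ ∣ q ∣
∣p∪q∣≤∣p∣+∣q∣ [] [] = z≤n
∣p∪q∣≤∣p∣+∣q∣ (outside ∷ p) (outside ∷ q) = ∣p∪q∣≤∣p∣+∣q∣ p q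
∣p∪q∣≤∣p∣+∣q∣ (outside ∷ p) (inside ∷ q) =
  ≤-trans (s≤s (∣p∪q∣≤∣p∣+∣q∣ p q)) (≤-reflexive (≡.sym (+-suc ∣ p ∣ ∣ q ∣)))
∣p∪q∣≤∣p∣+∣q∣ (inside ∷ p) (x ∷ q) =
  s≤s (≤-trans (∣p∪q∣≤∣p∣+∣q∣ p q) (+-monoʳ-≤ ∣ p ∣ (∣p∣≤∣x∷p∣ x q)))

image : ∀ {m k} → Subset m → (Fin m → Fin k) → Subset k
image []            f = ⊥
image (outside ∷ p) f = image p (f ∘ fsuc)
image (inside ∷ p)  f = ⁅ f fzero ⁆ ∪ image p (f ∘ fsuc)

∈image⇔ : ∀ {m k} {p : Subset m} {f : Fin m → Fin k} {y} → y ∈ image p f ⇔ ∃ λ i → i ∈ p × f i ≡ y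
∈image⇔ {p = p} {f} = mk⇔ (image⁻ p f) (λ { (i , i∈ , refl) → image⁺ p f i∈ })
  where
  image⁻ : ∀ {m k} (p : Subset m) (f : Fin m → Fin k) {y} → y ∈ image p f → ∃ λ i → i ∈ p × f i ≡ y
  image⁻ [] f y∈ = ⊥-elim (∉⊥ y∈)
  image⁻ (outside ∷ p) f y∈ with image⁻ p (f ∘ fsuc) y∈
  ... | i , i∈ , e = fsuc i , there i∈ , e
  image⁻ (inside ∷ p) f y∈ with x∈p∪q⁻ ⁅ f fzero ⁆ _ y∈
  ... | inj₁ y∈f0 = fzero , here , ≡.sym (x∈⁅y⁆⇒x≡y _ y∈f0)
  ... | inj₂ y∈rest with image⁻ p (f ∘ fsuc) y∈rest
  ...   | i , i∈ , e = fsuc i , there i∈ , e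

  image⁺ : ∀ {m k} (p : Subset m) (f : Fin m → Fin k) {i} → i ∈ p → f i ∈ image p f
  image⁺ (inside ∷ p)  f here       = x∈p∪q⁺ (inj₁ (x∈⁅x⁆ (f fzero)))
  image⁺ (outside ∷ p) f (there i∈) = image⁺ p (f ∘ fsuc) i∈
  image⁺ (inside ∷ p)  f (there i∈) = x∈p∪q⁺ {p = ⁅ f fzero ⁆} (inj₂ (image⁺ p (f ∘ fsuc) i∈))

∣image∣≤ : ∀ {m k} (p : Subset m) (f : Fin m → Fin k) → ∣ image p f ∣ ≤ ∣ p ∣
∣image∣≤ {k = k} [] f = ≤-reflexive (∣⊥∣≡0 k)
∣image∣≤ (outside ∷ p) f = ∣image∣≤ p (f ∘ fsuc)
∣image∣≤ (inside ∷ p) f = ≤-trans (∣p∪q∣≤∣p∣+∣q∣ ⁅ f fzero ⁆ _)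
  (+-mono-≤ (≤-reflexive (∣⁅x⁆∣≡1 (f fzero))) (∣image∣≤ p (f ∘ fsuc)))

module Combinations {c ℓ} (R : Semiring c ℓ) where
  open Semiring R renaming (refl to ≈-refl; sym to ≈-sym)

  combination : ∀ {i a} {I : Set i} {A : Set a} → (I → A → Carrier) → List (Carrier × I) → A → Carrier
  combination e cs x = foldr (λ p acc → proj₁ p * e (proj₂ p) x + acc) 0# cs

  ClassFunction : ∀ {a r} {A : Set a} → Rel A r → (A → Carrier) → Set _
  ClassFunction _~_ v = ∀ {x y} → x ~ y → v x ≈ v y

  combination-classFunction :
    ∀ {i a r p} {I : Set i} {A : Set a} {_~_ : Rel A r} {P : Pred I p} {e : I → A → Carrier} →
    (∀ {j} → P j → ClassFunction _~_ (e j)) →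
    ∀ {cs} → All (P ∘ proj₂) cs → ClassFunction _~_ (combination e cs)
  combination-classFunction e-class []                x~y = ≈-refl
  combination-classFunction e-class (Pj ∷ Pcs) x~y =
    +-cong (*-congˡ (e-class Pj x~y)) (combination-classFunction e-class Pcs x~y)

  -- Summing v σ · e_σ over one representative σ per class, where e_σ is the
  -- indicator of the class of σ; the representatives are collected greedily.
  classFunction⇒combination :
    ∀ {m r i p} {_~_ : Rel (Fin m) r} → IsDecEquivalence _~_ →
    ∀ {I : Set i} {P : Pred I p} (e : I → Fin m → Carrier) (rep : Fin m → I) →
    (∀ x → P (rep x)) →
    (∀ {x y} → x ~ y → e (rep x) y ≈ 1#) → (∀ {x y} → ¬ x ~ y → e (rep x) y ≈ 0#) →
    ∀ {v} → ClassFunction _~_ v →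
    Σ (List (Carrier × I)) λ cs → All (P ∘ proj₂) cs × (∀ y → v y ≈ combination e cs y)
  classFunction⇒combination {m} {_~_ = _~_} ~-isDecEquivalence {I = I} {P} e rep P-rep e-rep-~ e-rep-≁ {v} v-class =
    let cs , Pcs , on-classes = combination-on (allFin m)
    in  cs , Pcs , λ y → ≈-sym (proj₁ (on-classes y) (covered y))
    where
    open IsDecEquivalence ~-isDecEquivalence
      renaming (sym to ~-sym; trans to ~-trans; reflexive to ~-reflexive; _≟_ to _≟~_)

    OnClassesOf : List (Fin m) → (Fin m → Carrier) → Set _
    OnClassesOf L w = ∀ y → (Any (_~ y) L → w y ≈ v y) × (¬ Any (_~ y) L → w y ≈ 0#)

    combination-on : ∀ L → Σ (List (Carrier × I)) λ cs → All (P ∘ proj₂) cs × OnClassesOf L (combination e cs)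
    combination-on [] = [] , [] , λ y → (λ ()) , λ _ → ≈-refl
    combination-on (x ∷ L) with combination-on L | Any.any? (_≟~ x) L
    ... | cs , Pcs , on | yes x-met = cs , Pcs , λ y →
      (λ { (Any.here x~y) → proj₁ (on y) (Any.map (λ z~x → ~-trans z~x x~y) x-met)
         ; (Any.there y-met) → proj₁ (on y) y-met })
      , λ y-unmet → proj₂ (on y) (y-unmet ∘ Any.there)
    ... | cs , Pcs , on | no x-new = (v x , rep x) ∷ cs , P-rep x ∷ Pcs , λ y →
      (λ { (Any.here x~y) → begin
             v x * e (rep x) y + combination e cs y
               ≈⟨ +-cong (*-congˡ (e-rep-~ x~y)) (proj₂ (on y) (x-class-unmet x~y)) ⟩
             v x * 1# + 0#   ≈⟨ +-identityʳ _ ⟩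
             v x * 1#        ≈⟨ *-identityʳ _ ⟩
             v x             ≈⟨ v-class x~y ⟩
             v y             ∎
         ; (Any.there y-met) → begin
             v x * e (rep x) y + combination e cs y
               ≈⟨ +-cong (*-congˡ (e-rep-≁ (λ x~y → x-class-unmet x~y y-met))) (proj₁ (on y) y-met) ⟩
             v x * 0# + v y  ≈⟨ +-congʳ (zeroʳ _) ⟩
             0# + v y        ≈⟨ +-identityˡ _ ⟩
             v y             ∎ })
      , λ y-unmet → begin
             v x * e (rep x) y + combination e cs y
               ≈⟨ +-cong (*-congˡ (e-rep-≁ (y-unmet ∘ Any.here))) (proj₂ (on y) (y-unmet ∘ Any.there)) ⟩
             v x * 0# + 0#   ≈⟨ +-identityʳ _ ⟩
             v x * 0#        ≈⟨ zeroʳ _ ⟩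
             0#              ∎
      where
      open import Relation.Binary.Reasoning.Setoid setoid

      x-class-unmet : ∀ {y} → x ~ y → ¬ Any (_~ y) L
      x-class-unmet x~y = x-new ∘ Any.map (λ z~y → ~-trans z~y (~-sym x~y))

    covered : ∀ y → Any (_~ y) (allFin m)
    covered y = Any.map (λ y≡z → ~-reflexive (≡.sym y≡z)) (∈-allFin y)

module _ {n : ℕ} (X : Partite n) where
  open Partite X

  facet-side : ∀ {ω i x} → facet ω i ≡ x → facet ω (side x) ≡ x
  facet-side {ω} {i} refl = cong (facet ω) (typed ω i)

  ∈facetSet⇔ : ∀ {ω x} → x ∈ facetSet X ω ⇔ facet ω (side x) ≡ x
  ∈facetSet⇔ {ω} {x} = mk⇔
    (λ x∈ → let i , e = witness (≡.trans (≡.sym (lookup∘tabulate has x)) ([]=⇒lookup x∈))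
            in  facet-side e)
    (λ e → lookup⇒[]= x (facetSet X ω) (≡.trans (lookup∘tabulate has x) (dec-true (any? (λ i → facet ω i ≟ x)) (side x , e))))
    where
    has : Fin V → Bool
    has y = does (any? λ i → facet ω i ≟ y)
    witness : has x ≡ true → ∃ λ i → facet ω i ≡ x
    witness e = invert (subst (Reflects _) e (proof (any? λ i → facet ω i ≟ x)))

  facet∈facetSet : ∀ {ω} i → facet ω i ∈ facetSet X ω
  facet∈facetSet i = from ∈facetSet⇔ (facet-side refl)

  AgreeOn : Subset n → Fin F → Fin F → Set
  AgreeOn S σ τ = ∀ i → i ∈ S → facet σ i ≡ facet τ i

  agreeOn-isDecEquivalence : ∀ S → IsDecEquivalence (AgreeOn S)
  agreeOn-isDecEquivalence S = record
    { isEquivalence = record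
      { refl  = λ _ _ → refl
      ; sym   = λ σ~τ i i∈ → ≡.sym (σ~τ i i∈)
      ; trans = λ σ~τ τ~ρ i i∈ → ≡.trans (σ~τ i i∈) (τ~ρ i i∈)
      }
    ; _≟_ = λ σ τ → all? λ i → i ∈? S →-dec facet σ i ≟ facet τ i
    }

  agreeOn-antimono : ∀ {S S′ σ τ} → S ⊆ S′ → AgreeOn S′ σ τ → AgreeOn S σ τ
  agreeOn-antimono S⊆S′ σ~τ i i∈ = σ~τ i (S⊆S′ i∈)

  agreeOn-everywhere⇒≡ : ∀ {S σ τ} → (∀ i → i ∈ S) → AgreeOn S σ τ → σ ≡ τ
  agreeOn-everywhere⇒≡ all∈S σ~τ = distinct _ _ (λ i → σ~τ i (all∈S i))

  agreeOn-∁-remove : ∀ {B s σ τ} → AgreeOn (∁ B) σ τ → facet σ s ≡ facet τ s → AgreeOn (∁ (B - s)) σ τ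
  agreeOn-∁-remove {s = s} σ~τ σs≡τs i i∈ with i ≟ s
  ... | yes refl = σs≡τs
  ... | no i≢s = σ~τ i (x∉p⇒x∈∁p (λ i∈B → x∈∁p⇒x∉p i∈ (x∈p∧x≢y⇒x∈p-y i∈B i≢s)))

  restrict : Fin F → Subset n → Subset V
  restrict σ S = image S (facet σ)

  ∈restrict⇔ : ∀ {σ S x} → x ∈ restrict σ S ⇔ (side x ∈ S × facet σ (side x) ≡ x)
  ∈restrict⇔ {σ} {S} = mk⇔
    (side-of-image ∘ to ∈image⇔)
    (λ (s∈ , e) → from ∈image⇔ (side _ , s∈ , e))
    where
    side-of-image : ∀ {x} → ∃ (λ i → i ∈ S × facet σ i ≡ x) → side x ∈ S × facet σ (side x) ≡ x
    side-of-image (i , i∈ , refl) = subst (_∈ S) (≡.sym (typed σ i)) i∈ , facet-side refl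

  facet∈restrict : ∀ {σ S i} → i ∈ S → facet σ i ∈ restrict σ S
  facet∈restrict i∈ = from ∈image⇔ (_ , i∈ , refl)

  restrict⊆⇔agreeOn : ∀ {σ τ S} → restrict σ S ⊆ facetSet X τ ⇔ AgreeOn S σ τ
  restrict⊆⇔agreeOn {σ} {τ} = mk⇔
    (λ r⊆τ i i∈ → ≡.sym (≡.trans (cong (facet τ) (≡.sym (typed σ i))) (to ∈facetSet⇔ (r⊆τ (facet∈restrict i∈)))))
    (λ σ~τ {x} x∈ → let s∈ , e = to ∈restrict⇔ x∈ in from ∈facetSet⇔ (≡.trans (≡.sym (σ~τ _ s∈)) e))

  restrict-faceOfType : ∀ {σ S} → FaceOfType X S (restrict σ S)
  restrict-faceOfType {σ} {S} = (σ , from (restrict⊆⇔agreeOn {S = S}) (λ _ _ → refl)) , λ i → mk⇔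
    (λ i∈ → facet σ i , facet∈restrict i∈ , typed σ i)
    (λ (x , x∈ , e) → subst (_∈ S) e (proj₁ (to ∈restrict⇔ x∈)))

  ∣restrict∣≤∣S∣ : ∀ σ S → ∣ restrict σ S ∣ ≤ ∣ S ∣
  ∣restrict∣≤∣S∣ σ S = ∣image∣≤ S (facet σ)

  faceOfType-⊆-agreeOn : ∀ {S α σ τ} → FaceOfType X S α → AgreeOn S σ τ → α ⊆ facetSet X σ → α ⊆ facetSet X τ
  faceOfType-⊆-agreeOn (_ , α-type) σ~τ α⊆σ {x} x∈ =
    from ∈facetSet⇔ (≡.trans (≡.sym (σ~τ _ (from (α-type (side x)) (x , x∈ , refl)))) (to ∈facetSet⇔ (α⊆σ x∈)))

  module _ {c ℓ} (K : Field c ℓ) where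
    open Field K hiding (_-_; refl)
    open Combinations semiring

    u-⊆ : ∀ {α τ} → α ⊆ facetSet X τ → u X K α τ ≡ 1#
    u-⊆ {α} {τ} α⊆τ = cong (λ b → if b then 1# else 0#) (dec-true (α ⊆? facetSet X τ) α⊆τ)

    u-⊈ : ∀ {α τ} → ¬ α ⊆ facetSet X τ → u X K α τ ≡ 0#
    u-⊈ {α} {τ} α⊈τ = cong (λ b → if b then 1# else 0#) (dec-false (α ⊆? facetSet X τ) α⊈τ)

    u-classFunction : ∀ {S α} → FaceOfType X S α → ClassFunction (AgreeOn S) (u X K α)
    u-classFunction {α = α} α-type {σ} {τ} σ~τ = reflexive (cong (λ b → if b then 1# else 0#)
      (does-⇔ (mk⇔ (faceOfType-⊆-agreeOn α-type σ~τ) (faceOfType-⊆-agreeOn α-type (λ i i∈ → ≡.sym (σ~τ i i∈))))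
              (α ⊆? facetSet X σ) (α ⊆? facetSet X τ)))

    inU⇔classFunction : ∀ {T v} → InU X K T v ⇔ ClassFunction (AgreeOn (∁ T)) v
    inU⇔classFunction {T} = mk⇔
      (λ (cs , cs-types , v≈cs) σ~τ →
         trans (v≈cs _) (trans (combination-classFunction u-classFunction cs-types σ~τ) (sym (v≈cs _))))
      (classFunction⇒combination (agreeOn-isDecEquivalence (∁ T)) (u X K) (λ σ → restrict σ (∁ T))
         (λ _ → restrict-faceOfType)
         (λ σ~τ → reflexive (u-⊆ (from restrict⊆⇔agreeOn σ~τ)))
         (λ σ≁τ → reflexive (u-⊈ (σ≁τ ∘ to restrict⊆⇔agreeOn))))

    StarConstant : Subset V → Vector X K → Set ℓ
    StarConstant β v = ∀ {τ τ′} → β ⊆ facetSet X τ → β ⊆ facetSet X τ′ → v τ ≈ v τ′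

    starConstant-link-path : ∀ {α v} → (∀ x → LinkVertex X α x → StarConstant (α ∪ ⁅ x ⁆) v) →
      ∀ {x y τ τ′} → Star (LinkEdge X α) x y → LinkVertex X α x →
      α ∪ ⁅ x ⁆ ⊆ facetSet X τ → α ∪ ⁅ y ⁆ ⊆ facetSet X τ′ → v τ ≈ v τ′
    starConstant-link-path constant ε x-link x⊆τ y⊆τ′ = constant _ x-link x⊆τ y⊆τ′
    starConstant-link-path constant ((_ , z-link , _ , ρ , xz⊆ρ) ◅ path) x-link x⊆τ y⊆τ′ =
      trans (constant _ x-link x⊆τ (∪-∪-⊆⇒∪-⊆ˡ xz⊆ρ))
            (starConstant-link-path constant path z-link (∪-∪-⊆⇒∪-⊆ʳ xz⊆ρ) y⊆τ′)

    classFunction-step : AllLinksConnected X → ∀ {B t v} → 2 ≤ ∣ B ∣ → t ∈ B →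
      (∀ s → s ∈ B → ClassFunction (AgreeOn (∁ (B - s))) v) → ClassFunction (AgreeOn (∁ B)) v
    classFunction-step links {B} {t} {v} 2≤∣B∣ t∈B inv {σ} {ω} σ~ω =
      starConstant-link-path star-constant
        (links α (proj₁ (restrict-faceOfType {σ} {∁ B})) α-small _ _ (facet-t-link σ~σ) (facet-t-link σ~ω))
        (facet-t-link σ~σ) (facet-t-star σ~σ) (facet-t-star σ~ω)
      where
      α : Subset V
      α = restrict σ (∁ B)

      σ~σ : AgreeOn (∁ B) σ σ
      σ~σ _ _ = refl

      α-small : ∣ α ∣ +ℕ 2 ≤ n
      α-small = begin
        ∣ α ∣ +ℕ 2          ≤⟨ +-mono-≤ (∣restrict∣≤∣S∣ σ (∁ B)) 2≤∣B∣ ⟩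
        ∣ ∁ B ∣ +ℕ ∣ B ∣     ≡⟨ cong (_+ℕ ∣ B ∣) (∣∁p∣≡n∸∣p∣ B) ⟩
        n ∸ ∣ B ∣ +ℕ ∣ B ∣   ≡⟨ m∸n+n≡m (∣p∣≤n B) ⟩
        n                   ∎
        where open ≤-Reasoning

      star⇔ : ∀ {x τ} → α ∪ ⁅ x ⁆ ⊆ facetSet X τ ⇔ (AgreeOn (∁ B) σ τ × x ∈ facetSet X τ)
      star⇔ = ⇔.trans ∪⊆⇔ (restrict⊆⇔agreeOn ×-⇔ ⁅x⁆⊆⇔∈)

      outside-α : ∀ {x} → side x ∈ B → x ∉ α
      outside-α sx∈B x∈α = x∈∁p⇒x∉p (proj₁ (to ∈restrict⇔ x∈α)) sx∈B

      link-side : ∀ {x τ} → x ∉ α → α ∪ ⁅ x ⁆ ⊆ facetSet X τ → side x ∈ B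
      link-side x∉α x⊆τ = let σ~τ , x∈τ = to star⇔ x⊆τ in
        x∉∁p⇒x∈p λ sx∈∁B → x∉α (from ∈restrict⇔ (sx∈∁B , ≡.trans (σ~τ _ sx∈∁B) (to ∈facetSet⇔ x∈τ)))

      star-constant : ∀ x → LinkVertex X α x → StarConstant (α ∪ ⁅ x ⁆) v
      star-constant x (x∉α , _) x⊆τ x⊆τ′ =
        let σ~τ , x∈τ = to star⇔ x⊆τ ; σ~τ′ , x∈τ′ = to star⇔ x⊆τ′ in
        inv (side x) (link-side x∉α x⊆τ)
          (agreeOn-∁-remove (λ i i∈ → ≡.trans (≡.sym (σ~τ i i∈)) (σ~τ′ i i∈))
                            (≡.trans (to ∈facetSet⇔ x∈τ) (≡.sym (to ∈facetSet⇔ x∈τ′))))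

      facet-t-star : ∀ {τ} → AgreeOn (∁ B) σ τ → α ∪ ⁅ facet τ t ⁆ ⊆ facetSet X τ
      facet-t-star σ~τ = from star⇔ (σ~τ , facet∈facetSet t)

      facet-t-link : ∀ {τ} → AgreeOn (∁ B) σ τ → LinkVertex X α (facet τ t)
      facet-t-link {τ} σ~τ = outside-α (subst (_∈ B) (≡.sym (typed τ t)) t∈B) , τ , facet-t-star σ~τ

    classFunction-from-singletons : AllLinksConnected X → ∀ {T v} →
      (∀ t → t ∈ T → ClassFunction (AgreeOn (∁ ⁅ t ⁆)) v) → ClassFunction (AgreeOn (∁ T)) v
    classFunction-from-singletons links {T} {v} inv = classFunction-off T (On.wellFounded ∣_∣ <-wellFounded T) id
      where
      classFunction-off : ∀ B → Acc (_<_ on ∣_∣) B → B ⊆ T → ClassFunction (AgreeOn (∁ B)) v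
      classFunction-off B (acc smaller) B⊆T with nonempty? B
      ... | no B-empty = λ σ~τ →
        reflexive (cong v (agreeOn-everywhere⇒≡ (λ i → x∉p⇒x∈∁p λ i∈B → B-empty (i , i∈B)) σ~τ))
      ... | yes (t , t∈B) with nonempty? (B - t)
      ...   | no B-t-empty = λ σ~τ →
        inv t (B⊆T t∈B) (agreeOn-antimono (p⊆q⇒∁p⊇∁q (p-x-empty⇒p⊆⁅x⁆ B-t-empty)) σ~τ)
      ...   | yes (s , s∈B-t) = classFunction-step links (x∈p∧y∈p-x⇒2≤∣p∣ t∈B s∈B-t) t∈B λ s s∈B →
        classFunction-off (B - s) (smaller (x∈p⇒∣p-x∣<∣p∣ s∈B)) λ i∈ → B⊆T (proj₁ (x∈p⇒p-x⊂p s∈B) i∈)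

proposition3p3 : ∀ {c ℓ : Level} (K : Field c ℓ) (n : ℕ) (X : Partite n) →
    AllLinksConnected X →
    ∀ (T : Subset n) (v : Vector X K) →
      (InU X K T v ⇔ (∀ t → t ∈ T → InU X K ⁅ t ⁆ v))
proposition3p3 K n X links T v = mk⇔
  (λ v∈U t t∈T → from (inU⇔classFunction X K) λ σ~τ →
     to (inU⇔classFunction X K) v∈U (agreeOn-antimono X (p⊆q⇒∁p⊇∁q (from ⁅x⁆⊆⇔∈ t∈T)) σ~τ))
  (λ v∈U-singletons → from (inU⇔classFunction X K)
     (classFunction-from-singletons X K links λ t t∈T → to (inU⇔classFunction X K) (v∈U-singletons t t∈T)))
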